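{- Let $\mathcal{K}$ be the set of all positions of misère partizan Kayles. If $n\equiv 0\pmod 3$, then $S_n\equiv 0\pmod{\mathcal{K}}$.
   Context: Partizan Kayles is played on $1\times n$ strips of squares; $S_n$ denotes an empty strip of length $n$, and $0$ is the empty game. Left moves by placing a single square on one empty cell; Right moves by placing a domino covering two adjacent empty cells of the same strip; a placement splits a strip into the strips of empty cells on either side. $\mathcal{K}$ is the set of all disjunctive sums of strips. Under misère play a player unable to move on their turn wins; $o^-(G)$ is the misère outcome. $G\equiv H\pmod{\mathcal{K}}$ means $o^-(G+X)=o^-(H+X)$ for all $X\in\mathcal{K}$. -}

module Defs where

open import Data.Nat using (ℕ; suc; _+_)
open import Data.List using (List; []; _∷_; _++_)
open import Data.Product using (_×_; ∃)
open import Data.Empty using (⊥)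
open import Function.Bundles using (_⇔_)

-- A position of partizan Kayles (an element of 𝒦) is a disjunctive sum of
-- strips, represented as the list of strip lengths.  A strip of length 0
-- is the empty game.
Pos : Set
Pos = List ℕ

S : ℕ → Pos
S n = n ∷ []

zeroG : Pos
zeroG = []

_⊕_ : Pos → Pos → Pos
G ⊕ H = G ++ H

data StripL : ℕ → Pos → Set where
  square : ∀ a b → StripL (suc (a + b)) (a ∷ b ∷ [])

data StripR : ℕ → Pos → Set where
  domino : ∀ a b → StripR (suc (suc (a + b))) (a ∷ b ∷ [])

data LMove : Pos → Pos → Set where
  here  : ∀ {n ps g} → StripL n ps → LMove (n ∷ g) (ps ++ g)
  there : ∀ {n g g'} → LMove g g' → LMove (n ∷ g) (n ∷ g')

data RMove : Pos → Pos → Set where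
  here  : ∀ {n ps g} → StripR n ps → RMove (n ∷ g) (ps ++ g)
  there : ∀ {n g g'} → RMove g g' → RMove (n ∷ g) (n ∷ g')

-- Misère play: a player unable to move on their turn wins.
-- LeftFirst G  : Left wins G when Left moves first.
-- LeftSecond G : Left wins G when Right moves first.
data LeftFirst  : Pos → Set
data LeftSecond : Pos → Set

data LeftFirst where
  noMove : ∀ {G} → (∀ G' → LMove G G' → ⊥) → LeftFirst G
  move   : ∀ {G G'} → LMove G G' → LeftSecond G' → LeftFirst G

data LeftSecond where
  respond : ∀ {G} → ∃ (RMove G) → (∀ G' → RMove G G' → LeftFirst G') → LeftSecond G

-- Equality of misère outcomes: the winner is the same for each choice of
-- first player (games are finite, so the winner is determined).
SameOutcome : Pos → Pos → Set
SameOutcome G H = (LeftFirst G ⇔ LeftFirst H) × (LeftSecond G ⇔ LeftSecond H)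

_≡K_ : Pos → Pos → Set
G ≡K H = ∀ (X : Pos) → SameOutcome (G ⊕ X) (H ⊕ X)

-- Give a strip of length n the weight 0, 1 or −1 according as n ≡ 0, 1, 2 (mod 3), and a
-- position the sum of the weights of its strips.  Every Left move changes the weight by −1
-- or +2 and every Right move by +1 or −2, so each move shifts the weight by −1 or +1
-- (mod 3) according to the mover.  Left can always lower the weight by exactly 1 unless
-- every strip has length 0 or 2, and Right can always raise it by exactly 1 unless every
-- strip has length 0 or 1.  From this one shows by induction that Left wins moving first
-- exactly when the weight lies in {0, −3, −6, …}, and moving second exactly when the weight
-- lies in {−1, −4, −7, …}.  Hence the misère outcome of a position depends only on its
-- weight, and adding a strip whose length is a multiple of 3 does not change the weight.
module Submission where

open import Defs
open import Data.Nat using (ℕ; zero; suc; _<_; _*_; s≤s)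
open import Data.Nat.Divisibility using (_∣_; divides)
import Data.Nat.Properties as ℕ
open import Data.Nat.Induction using (<-wellFounded)
open import Data.Integer using (ℤ; +_; -[1+_]; 0ℤ; 1ℤ; -1ℤ; _+_; _-_)
import Data.Integer.Properties as ℤ
open import Data.List using ([]; _∷_)
open import Data.Nat.ListAction using (sum)
open import Data.Product using (_×_; _,_; ∃; ∃-syntax)
open import Data.Sum as Sum using (_⊎_; inj₁; inj₂; [_,_]′)
open import Data.Empty using (⊥-elim)
open import Function.Base using (id; _on_)
open import Function.Bundles using (_⇔_; mk⇔)
import Function.Properties.Equivalence as ⇔
open import Induction.WellFounded using (Acc; acc; WellFounded)
import Relation.Binary.Construct.On as On
open import Relation.Nullary using (¬_)
open import Relation.Binary.PropositionalEquality
  using (_≡_; refl; sym; trans; cong; subst; module ≡-Reasoning)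
open ≡-Reasoning

stripWeight : ℕ → ℤ
stripWeight 0 = 0ℤ
stripWeight 1 = 1ℤ
stripWeight 2 = -1ℤ
stripWeight (suc (suc (suc n))) = stripWeight n

weight : Pos → ℤ
weight [] = 0ℤ
weight (n ∷ G) = stripWeight n + weight G

stripWeight-*3 : ∀ q → stripWeight (q * 3) ≡ 0ℤ
stripWeight-*3 zero = refl
stripWeight-*3 (suc q) = stripWeight-*3 q

weight-⊕ : ∀ G H → weight (G ⊕ H) ≡ weight G + weight H
weight-⊕ [] H = sym (ℤ.+-identityˡ (weight H))
weight-⊕ (n ∷ G) H = begin
  stripWeight n + weight (G ⊕ H)         ≡⟨ cong (λ x → stripWeight n + x) (weight-⊕ G H) ⟩
  stripWeight n + (weight G + weight H)  ≡⟨ ℤ.+-assoc (stripWeight n) (weight G) (weight H) ⟨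
  (stripWeight n + weight G) + weight H  ∎

weight-here : ∀ n ps G {δ} → weight ps ≡ stripWeight n + δ →
              weight (ps ⊕ G) ≡ weight (n ∷ G) + δ
weight-here n ps G {δ} e = begin
  weight (ps ⊕ G)                 ≡⟨ weight-⊕ ps G ⟩
  weight ps + weight G            ≡⟨ cong (_+ weight G) e ⟩
  (stripWeight n + δ) + weight G  ≡⟨ ℤ.+-assoc (stripWeight n) δ (weight G) ⟩
  stripWeight n + (δ + weight G)  ≡⟨ cong (λ x → stripWeight n + x) (ℤ.+-comm δ (weight G)) ⟩
  stripWeight n + (weight G + δ)  ≡⟨ ℤ.+-assoc (stripWeight n) (weight G) δ ⟨
  weight (n ∷ G) + δ              ∎

weight-there : ∀ n G G' {δ} → weight G' ≡ weight G + δ →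
               weight (n ∷ G') ≡ weight (n ∷ G) + δ
weight-there n G G' {δ} e =
  trans (cong (λ x → stripWeight n + x) e) (sym (ℤ.+-assoc (stripWeight n) (weight G) δ))

square-weight : ∀ {n ps} → StripL n ps →
                weight ps ≡ stripWeight n - 1ℤ ⊎ weight ps ≡ stripWeight n + + 2
square-weight (square (suc (suc (suc a))) b) = square-weight (square a b)
square-weight (square 0 (suc (suc (suc b)))) = square-weight (square 0 b)
square-weight (square 1 (suc (suc (suc b)))) = square-weight (square 1 b)
square-weight (square 2 (suc (suc (suc b)))) = square-weight (square 2 b)
square-weight (square 0 0) = inj₁ refl
square-weight (square 0 1) = inj₂ refl
square-weight (square 0 2) = inj₁ refl
square-weight (square 1 0) = inj₂ refl
square-weight (square 1 1) = inj₂ refl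
square-weight (square 1 2) = inj₁ refl
square-weight (square 2 0) = inj₁ refl
square-weight (square 2 1) = inj₁ refl
square-weight (square 2 2) = inj₁ refl

domino-weight : ∀ {n ps} → StripR n ps →
                weight ps ≡ stripWeight n + 1ℤ ⊎ weight ps ≡ stripWeight n - + 2
domino-weight (domino (suc (suc (suc a))) b) = domino-weight (domino a b)
domino-weight (domino 0 (suc (suc (suc b)))) = domino-weight (domino 0 b)
domino-weight (domino 1 (suc (suc (suc b)))) = domino-weight (domino 1 b)
domino-weight (domino 2 (suc (suc (suc b)))) = domino-weight (domino 2 b)
domino-weight (domino 0 0) = inj₁ refl
domino-weight (domino 0 1) = inj₁ refl
domino-weight (domino 0 2) = inj₂ refl
domino-weight (domino 1 0) = inj₁ refl
domino-weight (domino 1 1) = inj₁ refl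
domino-weight (domino 1 2) = inj₁ refl
domino-weight (domino 2 0) = inj₂ refl
domino-weight (domino 2 1) = inj₁ refl
domino-weight (domino 2 2) = inj₂ refl

lmove-weight : ∀ {G G'} → LMove G G' →
               weight G' ≡ weight G - 1ℤ ⊎ weight G' ≡ weight G + + 2
lmove-weight (here {n} {ps} {g} s)  =
  Sum.map (weight-here n ps g) (weight-here n ps g) (square-weight s)
lmove-weight (there {n} {g} {g'} m) =
  Sum.map (weight-there n g g') (weight-there n g g') (lmove-weight m)

rmove-weight : ∀ {G G'} → RMove G G' →
               weight G' ≡ weight G + 1ℤ ⊎ weight G' ≡ weight G - + 2
rmove-weight (here {n} {ps} {g} s)  =
  Sum.map (weight-here n ps g) (weight-here n ps g) (domino-weight s)
rmove-weight (there {n} {g} {g'} m) =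
  Sum.map (weight-there n g g') (weight-there n g g') (rmove-weight m)

_≺_ : Pos → Pos → Set
_≺_ = _<_ on sum

≺-wellFounded : WellFounded _≺_
≺-wellFounded = On.wellFounded sum <-wellFounded

lmove-≺ : ∀ {G G'} → LMove G G' → G' ≺ G
lmove-≺ (here {g = g} (square a b)) = s≤s (ℕ.≤-reflexive (sym (ℕ.+-assoc a b (sum g))))
lmove-≺ (there {n = n} m)           = ℕ.+-monoʳ-< n (lmove-≺ m)

rmove-≺ : ∀ {G G'} → RMove G G' → G' ≺ G
rmove-≺ (here {g = g} (domino a b)) =
  s≤s (ℕ.m≤n⇒m≤1+n (ℕ.≤-reflexive (sym (ℕ.+-assoc a b (sum g)))))
rmove-≺ (there {n = n} m)           = ℕ.+-monoʳ-< n (rmove-≺ m)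

NoLMove : Pos → Set
NoLMove G = ∀ G' → ¬ LMove G G'

NoRMove : Pos → Set
NoRMove G = ∀ G' → ¬ RMove G G'

noLMove⇒weight≡0 : ∀ G → NoLMove G → weight G ≡ 0ℤ
noLMove⇒weight≡0 []          _     = refl
noLMove⇒weight≡0 (0 ∷ G)     stuck =
  trans (ℤ.+-identityˡ (weight G)) (noLMove⇒weight≡0 G (λ G' m → stuck _ (there m)))
noLMove⇒weight≡0 (suc n ∷ G) stuck = ⊥-elim (stuck _ (here (square 0 n)))

WeightLoweringLMove : Pos → Set
WeightLoweringLMove G = ∃[ G' ] LMove G G' × weight G' ≡ weight G - 1ℤ

WeightRaisingRMove : Pos → Set
WeightRaisingRMove G = ∃[ G' ] RMove G G' × weight G' ≡ weight G + 1ℤ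

-- In the last case every strip has length 0 or 2.
leftOptions : ∀ G →
  NoLMove G ⊎ WeightLoweringLMove G ⊎ (∃ (LMove G) × ∃[ j ] weight G ≡ -[1+ j ])
leftOptions [] = inj₁ (λ _ ())
leftOptions (0 ∷ g) with leftOptions g
... | inj₁ stuck                    = inj₁ λ { _ (here ()) ; _ (there m) → stuck _ m }
... | inj₂ (inj₁ (g' , m , e))      = inj₂ (inj₁ (0 ∷ g' , there m , weight-there 0 g g' e))
... | inj₂ (inj₂ ((g' , m) , j , e)) =
  inj₂ (inj₂ ((0 ∷ g' , there m) , j , trans (ℤ.+-identityˡ (weight g)) e))
leftOptions (1 ∷ g) =
  inj₂ (inj₁ (0 ∷ 0 ∷ g , here (square 0 0) , weight-here 1 (0 ∷ 0 ∷ []) g refl))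
leftOptions (2 ∷ g) with leftOptions g
... | inj₁ stuck                = inj₂ (inj₂ ((_ , here (square 0 1)) , 0 ,
                                   cong (λ x → -1ℤ + x) (noLMove⇒weight≡0 g stuck)))
... | inj₂ (inj₁ (g' , m , e))  = inj₂ (inj₁ (2 ∷ g' , there m , weight-there 2 g g' e))
... | inj₂ (inj₂ (_ , j , e))   = inj₂ (inj₂ ((_ , here (square 0 1)) , suc j ,
                                   cong (λ x → -1ℤ + x) e))
leftOptions (suc (suc (suc n)) ∷ g) =
  inj₂ (inj₁ (_ , here (square 2 n) , weight-here (suc (suc (suc n))) (2 ∷ n ∷ []) g splitWeight))
  where
  w : ℤ
  w = stripWeight n
  splitWeight : -1ℤ + (w + 0ℤ) ≡ w - 1ℤ
  splitWeight = trans (cong (λ x → -1ℤ + x) (ℤ.+-identityʳ w)) (ℤ.+-comm -1ℤ w)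

weightRaisingDomino : ∀ m →
  ∃[ ps ] StripR (suc (suc m)) ps × weight ps ≡ stripWeight (suc (suc m)) + 1ℤ
weightRaisingDomino 0 = _ , domino 0 0 , refl
weightRaisingDomino 1 = _ , domino 0 1 , refl
weightRaisingDomino 2 = _ , domino 1 1 , refl
weightRaisingDomino (suc (suc (suc m))) with weightRaisingDomino m
... | _ , domino a b , e = _ , domino (suc (suc (suc a))) b , e

rightOptions : ∀ G → WeightRaisingRMove G ⊎ (NoRMove G × ∃[ m ] weight G ≡ + m)
rightOptions [] = inj₂ ((λ _ ()) , 0 , refl)
rightOptions (0 ∷ g) with rightOptions g
... | inj₁ (g' , r , e)        = inj₁ (0 ∷ g' , there r , weight-there 0 g g' e)
... | inj₂ (stuck , m , e)     =
  inj₂ ((λ { _ (here ()) ; _ (there r) → stuck _ r }) , m , cong (λ x → 0ℤ + x) e)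
rightOptions (1 ∷ g) with rightOptions g
... | inj₁ (g' , r , e)        = inj₁ (1 ∷ g' , there r , weight-there 1 g g' e)
... | inj₂ (stuck , m , e)     =
  inj₂ ((λ { _ (here ()) ; _ (there r) → stuck _ r }) , suc m , cong (λ x → 1ℤ + x) e)
rightOptions (suc (suc m) ∷ g) with weightRaisingDomino m
... | ps , s , e = inj₁ (ps ⊕ g , here s , weight-here (suc (suc m)) ps g e)

NonPosMul3 : ℤ → Set
NonPosMul3 z = ∃[ k ] z + + (k * 3) ≡ 0ℤ

nonPosMul3-0 : NonPosMul3 0ℤ
nonPosMul3-0 = 0 , refl

nonPosMul3-drop3 : ∀ z → NonPosMul3 (z + + 3) → NonPosMul3 z
nonPosMul3-drop3 z (k , e) = suc k , trans (sym (ℤ.+-assoc z (+ 3) (+ (k * 3)))) e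

nonPosMul3-add3 : ∀ {z j} → z ≡ -[1+ j ] → NonPosMul3 z → NonPosMul3 (z + + 3)
nonPosMul3-add3 {z} neg (zero , e) with trans (sym neg) (trans (sym (ℤ.+-identityʳ z)) e)
... | ()
nonPosMul3-add3 {z} neg (suc k , e) = k , trans (ℤ.+-assoc z (+ 3) (+ (k * 3))) e

¬nonPosMul3-pos : ∀ m → ¬ NonPosMul3 (+ suc m)
¬nonPosMul3-pos m (_ , ())

+-shift : ∀ z δ c {z'} → z' ≡ z + δ → z' + c ≡ z + (δ + c)
+-shift z δ c e = trans (cong (_+ c) e) (ℤ.+-assoc z δ c)

≡-1⇒+1≡ : ∀ z {z'} → z' ≡ z - 1ℤ → z' + 1ℤ ≡ z
≡-1⇒+1≡ z e = trans (+-shift z -1ℤ 1ℤ e) (ℤ.+-identityʳ z)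

lmove-weight+1 : ∀ {G G'} → LMove G G' →
                 weight G' + 1ℤ ≡ weight G ⊎ weight G' + 1ℤ ≡ weight G + + 3
lmove-weight+1 {G} m =
  Sum.map (≡-1⇒+1≡ (weight G)) (+-shift (weight G) (+ 2) 1ℤ) (lmove-weight m)

rmove-weight+3 : ∀ {G G'} → RMove G G' →
                 weight G' ≡ weight G + 1ℤ ⊎ weight G' + + 3 ≡ weight G + 1ℤ
rmove-weight+3 {G} m = Sum.map id (+-shift (weight G) -[1+ 1 ] (+ 3)) (rmove-weight m)

leftFirst⇒weight  : ∀ {G} → LeftFirst G  → NonPosMul3 (weight G)
leftSecond⇒weight : ∀ {G} → LeftSecond G → NonPosMul3 (weight G + 1ℤ)

leftFirst⇒weight {G} (noMove stuck) =
  subst NonPosMul3 (sym (noLMove⇒weight≡0 G stuck)) nonPosMul3-0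
leftFirst⇒weight {G} (move m ls) =
  [ (λ e → subst NonPosMul3 e (leftSecond⇒weight ls))
  , (λ e → nonPosMul3-drop3 (weight G) (subst NonPosMul3 e (leftSecond⇒weight ls)))
  ]′ (lmove-weight+1 m)

leftSecond⇒weight {G} (respond (_ , r) replies) with rightOptions G
... | inj₁ (G' , r' , e)  = subst NonPosMul3 e (leftFirst⇒weight (replies G' r'))
... | inj₂ (stuck , _)    = ⊥-elim (stuck _ r)

weight⇒leftFirst  : ∀ {G} → Acc _≺_ G → NonPosMul3 (weight G) → LeftFirst G
weight⇒leftSecond : ∀ {G} → Acc _≺_ G → NonPosMul3 (weight G + 1ℤ) → LeftSecond G

weight⇒leftFirst {G} (acc rs) p with leftOptions G
... | inj₁ stuck = noMove stuck
... | inj₂ (inj₁ (_ , m , e)) =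
  move m (weight⇒leftSecond (rs (lmove-≺ m)) (subst NonPosMul3 (sym (≡-1⇒+1≡ (weight G) e)) p))
-- Here the weight is negative, so it stays in {0, −3, …} when raised by 3 and either shift works.
... | inj₂ (inj₂ ((_ , m) , _ , neg)) =
  move m (weight⇒leftSecond (rs (lmove-≺ m))
    ([ (λ e → subst NonPosMul3 (sym e) p)
     , (λ e → subst NonPosMul3 (sym e) (nonPosMul3-add3 neg p))
     ]′ (lmove-weight+1 m)))

weight⇒leftSecond {G} (acc rs) p with rightOptions G
... | inj₁ (G' , r , _) = respond (G' , r) λ G'' r'' →
  weight⇒leftFirst (rs (rmove-≺ r''))
    ([ (λ e → subst NonPosMul3 (sym e) p)
     , (λ e → nonPosMul3-drop3 (weight G'') (subst NonPosMul3 (sym e) p))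
     ]′ (rmove-weight+3 r''))
... | inj₂ (_ , m , e) = ⊥-elim (¬nonPosMul3-pos m (subst NonPosMul3 positive p))
  where
  positive : weight G + 1ℤ ≡ + suc m
  positive = trans (cong (_+ 1ℤ) e) (ℤ.+-comm (+ m) 1ℤ)

leftFirst⇔weight : ∀ G → LeftFirst G ⇔ NonPosMul3 (weight G)
leftFirst⇔weight G = mk⇔ leftFirst⇒weight (weight⇒leftFirst (≺-wellFounded G))

leftSecond⇔weight : ∀ G → LeftSecond G ⇔ NonPosMul3 (weight G + 1ℤ)
leftSecond⇔weight G = mk⇔ leftSecond⇒weight (weight⇒leftSecond (≺-wellFounded G))

sameWeight⇒sameOutcome : ∀ {G H} → weight G ≡ weight H → SameOutcome G H
sameWeight⇒sameOutcome {G} {H} e =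
  ⇔.trans (leftFirst⇔weight G)
    (subst (λ z → NonPosMul3 z ⇔ LeftFirst H) (sym e) (⇔.sym (leftFirst⇔weight H))) ,
  ⇔.trans (leftSecond⇔weight G)
    (subst (λ z → NonPosMul3 (z + 1ℤ) ⇔ LeftSecond H) (sym e) (⇔.sym (leftSecond⇔weight H)))

corollary4p3 : ∀ (n : ℕ) → 3 ∣ n → S n ≡K zeroG
corollary4p3 n (divides q refl) X = sameWeight⇒sameOutcome (begin
  stripWeight (q * 3) + weight X  ≡⟨ cong (_+ weight X) (stripWeight-*3 q) ⟩
  0ℤ + weight X                   ≡⟨ ℤ.+-identityˡ (weight X) ⟩
  weight X                        ∎)
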